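{- Run the following algorithm on a properly vertex-colored digraph $(\vec G=(V,E),\sigma)$ with $V\neq\emptyset$, with an arbitrary rule for choosing partitions: initialize $\vec G^*\leftarrow\vec G$; call $\mathrm{Edit}(V)$, where $\mathrm{Edit}(V')$ does the following: if $|V'|>1$, choose a partition $\mathscr V$ of $V'$ with $|\mathscr V|\ge 2$, replace $\vec G^*$ by $\vec G^*\triangle U(\vec G^*[V'],\mathscr V)$ (the set $U$ being computed for the current $\vec G^*$ at the start of this step), and then call $\mathrm{Edit}(V_i)$ for each $V_i\in\mathscr V$; if $|V'|=1$, do nothing. Then all edit sets $U(\vec G^*[V'],\mathscr V)$ constructed during the run (over all recursive calls) are pairwise disjoint.
   Context: A digraph $\vec G=(V,E)$ has a finite vertex set and arc set $E\subseteq (V\times V)\setminus\{(v,v)\mid v\in V\}$; $\vec G\triangle F=(V,E\triangle F)$; $\vec G[W]$ is the induced subgraph on $W$, colored by $\sigma_{|W}$. A vertex coloring $\sigma$ is proper if adjacent vertices have distinct colors. All rooted trees are phylogenetic (every non-leaf vertex has at least two children); $L(T)$ is the leaf set, $\rho_T$ the root, $T(v)$ the subtree rooted at $v$, $\mathrm{child}_T(v)$ the children of $v$; $u\preceq_T v$ means $v$ lies on the path from $u$ to the root; $\mathrm{lca}_T$ is the last common ancestor. For a tree $T$ with leaf coloring $\sigma$, a leaf $y$ is a best match of a leaf $x$ if $\sigma(x)\ne\sigma(y)$ and $\mathrm{lca}_T(x,y)\preceq_T\mathrm{lca}_T(x,y')$ for all leaves $y'$ with $\sigma(y')=\sigma(y)$;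 the best match graph $\vec G(T,\sigma)$ has vertex set $L(T)$ and arcs $(x,y)$ whenever $y$ is a best match of $x$. For a colored digraph $(\vec H=(W,E_H),\tau)$ and tree $T$ with $L(T)=W$, $U(\vec H,T)=E_H\triangle E(\vec G(T,\tau))$. For a partition $\mathscr W$ of $W$ with $|\mathscr W|\ge 2$, $\mathscr T(\mathscr W)$ is the set of phylogenetic trees $T$ with $L(T)=W$ and $\{L(T(v))\mid v\in\mathrm{child}_T(\rho_T)\}=\mathscr W$, and $U(\vec H,\mathscr W)=\bigcap_{T\in\mathscr T(\mathscr W)}U(\vec H,T)$. -}

module Defs where

open import Data.Nat using (ℕ; _≤_; _<_)
open import Data.Fin using (Fin)
open import Data.Fin.Subset using (Subset; _∈_; ∣_∣; Nonempty; _⊆_)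
open import Data.List using (List; []; _∷_; _++_; length; lookup)
open import Data.List.Relation.Unary.All using (All)
open import Data.List.Relation.Unary.Any using (Any)
open import Data.List.Relation.Unary.Unique.Propositional using (Unique)
import Data.List.Membership.Propositional as LM
open import Data.Product using (Σ; _×_; ∃)
open import Data.Sum using (_⊎_)
open import Data.Empty using (⊥)
open import Relation.Nullary using (¬_)
open import Relation.Binary.PropositionalEquality using (_≡_; _≢_)
open import Function.Bundles using (_⇔_)

Graph : ℕ → Set₁
Graph n = Fin n → Fin n → Set

infixl 6 _△_
_△_ : ∀ {n} → Graph n → Graph n → Graph n
(A △ B) x y = (A x y × ¬ B x y) ⊎ (B x y × ¬ A x y)

Loopless : ∀ {n} → Graph n → Set
Loopless {n} E = ∀ (v : Fin n) → ¬ E v v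

Proper : ∀ {n} {C : Set} → Graph n → (Fin n → C) → Set
Proper E σ = ∀ x y → E x y → σ x ≢ σ y

data Tree (n : ℕ) : Set where
  leaf : Fin n → Tree n
  node : List (Tree n) → Tree n

data Phylo {n} : Tree n → Set where
  leafP : ∀ {x} → Phylo (leaf x)
  nodeP : ∀ {cs} → 2 ≤ length cs → All Phylo cs → Phylo (node cs)

mutual
  leaves : ∀ {n} → Tree n → List (Fin n)
  leaves (leaf x) = x ∷ []
  leaves (node cs) = leavesL cs

  leavesL : ∀ {n} → List (Tree n) → List (Fin n)
  leavesL [] = []
  leavesL (c ∷ cs) = leaves c ++ leavesL cs

-- s ⊑ t : s is a subtree of t ; for a tree with distinct leaf labels,
-- vertices of T are the s with s ⊑ T, and u ⪯_T v is u ⊑ v.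
data _⊑_ {n} : Tree n → Tree n → Set where
  here  : ∀ {t} → t ⊑ t
  there : ∀ {s c cs} → c LM.∈ cs → s ⊑ c → s ⊑ node cs

_∈L_ : ∀ {n} → Fin n → Tree n → Set
x ∈L v = leaf x ⊑ v

IsLca : ∀ {n} → Tree n → Tree n → Fin n → Fin n → Set
IsLca T v x y =
  v ⊑ T × x ∈L v × y ∈L v ×
  (∀ w → w ⊑ T → x ∈L w → y ∈L w → v ⊑ w)

BestMatch : ∀ {n} {C : Set} → (Fin n → C) → Tree n → Graph n
BestMatch σ T x y =
  x ∈L T × y ∈L T × σ x ≢ σ y ×
  (∀ y' → y' ∈L T → σ y' ≡ σ y →
     ∀ a b → IsLca T a x y → IsLca T b x y' → a ⊑ b)

IsPartition : ∀ {n} → Subset n → List (Subset n) → Set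
IsPartition {n} W 𝒲 =
  All Nonempty 𝒲 ×
  All (_⊆ W) 𝒲 ×
  (∀ (x : Fin n) → x ∈ W → Any (x ∈_) 𝒲) ×
  (∀ (i j : Fin (length 𝒲)) → i ≢ j →
     ∀ x → x ∈ lookup 𝒲 i → x ∈ lookup 𝒲 j → ⊥)

SameLeaves : ∀ {n} → Tree n → Subset n → Set
SameLeaves c P = ∀ x → (x ∈L c) ⇔ (x ∈ P)

InTrees : ∀ {n} → Subset n → List (Subset n) → Tree n → Set
InTrees W 𝒲 T =
  Phylo T × Unique (leaves T) × (∀ x → (x ∈ W) ⇔ (x ∈L T)) ×
  Σ (List (Tree _)) (λ cs → T ≡ node cs ×
     All (λ c → Any (SameLeaves c) 𝒲) cs ×
     All (λ P → Any (λ c → SameLeaves c P) cs) 𝒲)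

Uset : ∀ {n} {C : Set} → (Fin n → C) → Graph n → Subset n → List (Subset n) → Graph n
Uset σ G W 𝒲 x y =
  x ∈ W × y ∈ W ×
  (∀ T → InTrees W 𝒲 T → (G △ BestMatch σ T) x y)

-- Runs of the algorithm (any choice rule).
-- Run σ V' G G' us : calling Edit(V') with current graph G* = G ends with
-- G* = G', and produces the edit sets us (in order of construction).

mutual
  data Run {n} {C : Set} (σ : Fin n → C) : Subset n → Graph n → Graph n → List (Graph n) → Set₁ where
    single : ∀ {V' G} → ∣ V' ∣ ≡ 1 → Run σ V' G G []
    split  : ∀ {V' G G' us} (𝒱 : List (Subset n)) →
             1 < ∣ V' ∣ → IsPartition V' 𝒱 → 2 ≤ length 𝒱 →
             RunAll σ 𝒱 (G △ Uset σ G V' 𝒱) G' us →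
             Run σ V' G G' (Uset σ G V' 𝒱 ∷ us)

  data RunAll {n} {C : Set} (σ : Fin n → C) : List (Subset n) → Graph n → Graph n → List (Graph n) → Set₁ where
    done : ∀ {G} → RunAll σ [] G G []
    next : ∀ {V Vs G G₁ G₂ us vs} →
           Run σ V G G₁ us → RunAll σ Vs G₁ G₂ vs →
           RunAll σ (V ∷ Vs) G G₂ (us ++ vs)

PairwiseDisjoint : ∀ {n} → List (Graph n) → Set
PairwiseDisjoint us =
  ∀ (i j : Fin (length us)) → i ≢ j →
    ∀ x y → lookup us i x y → lookup us j x y → ⊥

-- Every arc of an edit set U(G*[V'], 𝒱) joins two differently coloured vertices, and all
-- later edit sets of the run only contain arcs inside a single part of 𝒱.  An arc between
-- different parts is therefore never edited again.  If (x, y) ∈ U lies inside a part Q,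
-- compare a tree of 𝒯(𝒱) in which x, y form a cherry (there y is a best match of x) with
-- one in which x forms a cherry with a vertex z ≠ y of y's colour (there it is not): this
-- shows that (x, y) was not an arc of G* and that y is the only vertex of its colour in Q.
-- After the edit (x, y) is an arc, y stays the only vertex of its colour in every later
-- vertex set containing x and y, so y is a best match of x in every tree considered later
-- and (x, y) never enters another edit set.  Edit sets produced below different parts are
-- disjoint because the parts are.

module Submission where

open import Defs
open import Data.Nat using (ℕ; _<_; _≤_; s≤s; z≤n)
open import Data.Fin using (Fin; zero; suc; _≟_)
open import Data.Fin.Subset using (Subset; ⊤; _∈_; _⊆_; Nonempty)
open import Data.Fin.Subset.Properties using (_∈?_)
open import Data.List using (List; []; _∷_; _++_; map; concat; filter; length; allFin)
open import Data.List.Properties using (length-map; filter-accept; tabulate-lookup)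
open import Data.List.Relation.Unary.All as All using (All; []; _∷_)
import Data.List.Relation.Unary.All.Properties as AllP
open import Data.List.Relation.Unary.Any as Any using (Any; here; there)
import Data.List.Relation.Unary.Any.Properties as AnyP
open import Data.List.Relation.Unary.AllPairs as AllPairs using (AllPairs; []; _∷_)
import Data.List.Relation.Unary.AllPairs.Properties as AllPairsP
open import Data.List.Relation.Unary.Unique.Propositional using (Unique)
import Data.List.Relation.Unary.Unique.Propositional.Properties as UniqueP
open import Data.List.Relation.Binary.Disjoint.Propositional using (Disjoint)
open import Data.List.Membership.Propositional using (find) renaming (_∈_ to _∈ₗ_)
open import Data.List.Membership.Propositional.Properties
  using (∈-++⁺ˡ; ∈-++⁺ʳ; ∈-++⁻; ∈-map⁺; ∈-map⁻; ∈-filter⁺; ∈-filter⁻; ∈-allFin; ∈-lookup)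
import Data.List.Membership.DecPropositional as DecMembership
open module FinListMembership {n} = DecMembership (_≟_ {n}) using (_∉?_) renaming (_∈?_ to _∈ₗ?_)
open import Data.Product using (_×_; _,_; proj₁; proj₂; ∃)
open import Data.Sum using (_⊎_; inj₁; inj₂; [_,_]′)
open import Data.Empty using (⊥; ⊥-elim)
open import Function using (_∘_)
open import Relation.Nullary using (¬_; yes; no)
open import Relation.Binary.PropositionalEquality using (_≡_; _≢_; refl; sym; trans; cong; subst)
open import Function.Bundles using (_⇔_; mk⇔; Equivalence)

⊑-trans : ∀ {n} {s t u : Tree n} → s ⊑ t → t ⊑ u → s ⊑ u
⊑-trans p here = p
⊑-trans p (there c∈cs q) = there c∈cs (⊑-trans p q)

⊑-leaf : ∀ {n} {s : Tree n} {z} → s ⊑ leaf z → s ≡ leaf z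
⊑-leaf here = refl

∈L-leaf : ∀ {n} {x z : Fin n} → x ∈L leaf z → x ≡ z
∈L-leaf here = refl

∈L-node⁻ : ∀ {n} {x : Fin n} {cs} → x ∈L node cs → Any (x ∈L_) cs
∈L-node⁻ (there c∈cs x∈c) = Any.map (λ { refl → x∈c }) c∈cs

∈L-node⁺ : ∀ {n} {x : Fin n} {cs} → Any (x ∈L_) cs → x ∈L node cs
∈L-node⁺ x∈some = let (_ , c∈cs , x∈c) = find x∈some in there c∈cs x∈c

leaves-child⊆ : ∀ {n} {x : Fin n} {c cs} → c ∈ₗ cs → x ∈ₗ leaves c → x ∈ₗ leavesL cs
leaves-child⊆ {cs = c ∷ _} (here refl) x∈c = ∈-++⁺ˡ x∈c
leaves-child⊆ {cs = c ∷ _} (there c∈cs) x∈c = ∈-++⁺ʳ (leaves c) (leaves-child⊆ c∈cs x∈c)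

∈L⇒∈leaves : ∀ {n} {x : Fin n} {t} → x ∈L t → x ∈ₗ leaves t
∈L⇒∈leaves here = here refl
∈L⇒∈leaves (there c∈cs x∈c) = leaves-child⊆ c∈cs (∈L⇒∈leaves x∈c)

mutual
  ∈leaves⇒∈L : ∀ {n} {x : Fin n} t → x ∈ₗ leaves t → x ∈L t
  ∈leaves⇒∈L (leaf z) (here refl) = here
  ∈leaves⇒∈L (node cs) x∈ = ∈L-node⁺ (∈leavesL⇒Any cs x∈)

  ∈leavesL⇒Any : ∀ {n} {x : Fin n} cs → x ∈ₗ leavesL cs → Any (x ∈L_) cs
  ∈leavesL⇒Any (c ∷ cs) x∈ with ∈-++⁻ (leaves c) x∈
  ... | inj₁ x∈c = here (∈leaves⇒∈L c x∈c)
  ... | inj₂ x∈cs = there (∈leavesL⇒Any cs x∈cs)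

leavesL≡concat : ∀ {n} (cs : List (Tree n)) → leavesL cs ≡ concat (map leaves cs)
leavesL≡concat [] = refl
leavesL≡concat (c ∷ cs) = cong (leaves c ++_) (leavesL≡concat cs)

Unique-++⁻ : ∀ {A : Set} (xs : List A) {ys} → Unique (xs ++ ys) →
             Unique xs × Unique ys × Disjoint xs ys
Unique-++⁻ [] ys! = [] , ys! , λ ()
Unique-++⁻ (x ∷ xs) (x∉ ∷ xs++ys!) =
  let xs! , ys! , xs#ys = Unique-++⁻ xs xs++ys!
      separate : Disjoint (x ∷ xs) _
      separate = λ { (here refl , v∈ys) → All.lookup (AllP.++⁻ʳ xs x∉) v∈ys refl
                   ; (there v∈xs , v∈ys) → xs#ys (v∈xs , v∈ys) }
  in (AllP.++⁻ˡ xs x∉ ∷ xs!) , ys! , separate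

child-leaves-unique : ∀ {n} {c : Tree n} {cs} → c ∈ₗ cs → Unique (leavesL cs) → Unique (leaves c)
child-leaves-unique {cs = c ∷ _} (here refl) u = proj₁ (Unique-++⁻ (leaves c) u)
child-leaves-unique {cs = c ∷ _} (there c∈cs) u = child-leaves-unique c∈cs (proj₁ (proj₂ (Unique-++⁻ (leaves c) u)))

children-sharing-leaf : ∀ {n} {x : Fin n} {c₁ c₂ cs} → Unique (leavesL cs) → c₁ ∈ₗ cs → c₂ ∈ₗ cs →
                        x ∈ₗ leaves c₁ → x ∈ₗ leaves c₂ → c₁ ≡ c₂
children-sharing-leaf _ (here refl) (here refl) _ _ = refl
children-sharing-leaf {cs = c ∷ _} u (here refl) (there c₂∈) x∈c x∈c₂ =
  ⊥-elim (proj₂ (proj₂ (Unique-++⁻ (leaves c) u)) (x∈c , leaves-child⊆ c₂∈ x∈c₂))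
children-sharing-leaf {cs = c ∷ _} u (there c₁∈) (here refl) x∈c₁ x∈c =
  ⊥-elim (proj₂ (proj₂ (Unique-++⁻ (leaves c) u)) (x∈c , leaves-child⊆ c₁∈ x∈c₁))
children-sharing-leaf {cs = c ∷ _} u (there c₁∈) (there c₂∈) =
  children-sharing-leaf (proj₁ (proj₂ (Unique-++⁻ (leaves c) u))) c₁∈ c₂∈

⊑-comparable : ∀ {n} {x : Fin n} {t w₁ w₂} → Unique (leaves t) → w₁ ⊑ t → w₂ ⊑ t →
               x ∈L w₁ → x ∈L w₂ → w₁ ⊑ w₂ ⊎ w₂ ⊑ w₁
⊑-comparable _ here w₂⊑t _ _ = inj₂ w₂⊑t
⊑-comparable _ (there c∈cs w₁⊑c) here _ _ = inj₁ (there c∈cs w₁⊑c)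
⊑-comparable u (there c₁∈ w₁⊑c₁) (there c₂∈ w₂⊑c₂) x∈w₁ x∈w₂
  with children-sharing-leaf u c₁∈ c₂∈ (∈L⇒∈leaves (⊑-trans x∈w₁ w₁⊑c₁)) (∈L⇒∈leaves (⊑-trans x∈w₂ w₂⊑c₂))
... | refl = ⊑-comparable (child-leaves-unique c₁∈ u) w₁⊑c₁ w₂⊑c₂ x∈w₁ x∈w₂

IsLca-node : ∀ {n} {T : Tree n} {cs x y} → Unique (leaves T) → node cs ⊑ T →
             x ∈L node cs → y ∈L node cs → (∀ {c} → c ∈ₗ cs → x ∈L c → y ∈L c → ⊥) →
             IsLca T (node cs) x y
IsLca-node {T = T} {cs} {x} {y} u v⊑T x∈v y∈v separated = v⊑T , x∈v , y∈v , least
  where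
    least : ∀ w → w ⊑ T → x ∈L w → y ∈L w → node cs ⊑ w
    least w w⊑T x∈w y∈w with ⊑-comparable u v⊑T w⊑T x∈v x∈w
    ... | inj₁ v⊑w = v⊑w
    ... | inj₂ here = here
    ... | inj₂ (there c∈cs w⊑c) = ⊥-elim (separated c∈cs (⊑-trans x∈w w⊑c) (⊑-trans y∈w w⊑c))

cherry : ∀ {n} → Fin n → Fin n → Tree n
cherry x z = node (leaf x ∷ leaf z ∷ [])

∈L-cherry : ∀ {n} {w x z : Fin n} → w ∈L cherry x z → w ≡ x ⊎ w ≡ z
∈L-cherry (there (here refl) w∈x) = inj₁ (∈L-leaf w∈x)
∈L-cherry (there (there (here refl)) w∈z) = inj₂ (∈L-leaf w∈z)

∈L-leaf-child⇒≡ : ∀ {n} {x y : Fin n} {c zs} → c ∈ₗ map leaf zs → x ∈L c → y ∈L c → x ≡ y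
∈L-leaf-child⇒≡ {zs = zs} c∈ x∈c y∈c with ∈-map⁻ leaf {xs = zs} c∈
... | _ , _ , refl = trans (∈L-leaf x∈c) (sym (∈L-leaf y∈c))

-- node [] is a junk value: the empty list has no phylogenetic tree.
cherryStar : ∀ {n} → List (Fin n) → Tree n
cherryStar [] = node []
cherryStar (a ∷ []) = leaf a
cherryStar (a ∷ b ∷ []) = cherry a b
cherryStar (a ∷ b ∷ c ∷ rest) = node (cherry a b ∷ map leaf (c ∷ rest))

leavesL-map-leaf : ∀ {n} (l : List (Fin n)) → leavesL (map leaf l) ≡ l
leavesL-map-leaf [] = refl
leavesL-map-leaf (a ∷ l) = cong (a ∷_) (leavesL-map-leaf l)

leaves-cherryStar : ∀ {n} (l : List (Fin n)) → leaves (cherryStar l) ≡ l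
leaves-cherryStar [] = refl
leaves-cherryStar (a ∷ []) = refl
leaves-cherryStar (a ∷ b ∷ []) = refl
leaves-cherryStar (a ∷ b ∷ c ∷ rest) = cong (λ l → a ∷ b ∷ l) (leavesL-map-leaf (c ∷ rest))

cherryStar-phylo : ∀ {n} {x : Fin n} {l} → x ∈ₗ l → Phylo (cherryStar l)
cherryStar-phylo {l = a ∷ []} _ = leafP
cherryStar-phylo {l = a ∷ b ∷ []} _ = nodeP (s≤s (s≤s z≤n)) (leafP ∷ leafP ∷ [])
cherryStar-phylo {l = a ∷ b ∷ c ∷ rest} _ =
  nodeP (s≤s (s≤s z≤n)) (nodeP (s≤s (s≤s z≤n)) (leafP ∷ leafP ∷ []) ∷ AllP.map⁺ (All.universal (λ _ → leafP) (c ∷ rest)))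

cherry⊑cherryStar : ∀ {n} (a b : Fin n) rest → cherry a b ⊑ cherryStar (a ∷ b ∷ rest)
cherry⊑cherryStar a b [] = here
cherry⊑cherryStar a b (c ∷ rest) = there (here refl) here

module _ {n : ℕ} {C : Set} (σ : Fin n → C) where

  sole-colour⇒BestMatch : ∀ {T x y} → x ∈L T → y ∈L T → σ x ≢ σ y →
                          (∀ y' → y' ∈L T → σ y' ≡ σ y → y' ≡ y) → BestMatch σ T x y
  sole-colour⇒BestMatch {T} {x} {y} x∈T y∈T σx≢σy sole = x∈T , y∈T , σx≢σy , nearest
    where
      nearest : ∀ y' → y' ∈L T → σ y' ≡ σ y → ∀ a b → IsLca T a x y → IsLca T b x y' → a ⊑ b
      nearest y' y'∈T σy'≡σy a b (_ , _ , _ , a-least) (b⊑T , x∈b , y'∈b , _)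
        with sole y' y'∈T σy'≡σy
      ... | refl = a-least b b⊑T x∈b y'∈b

  cherry⇒BestMatch : ∀ {T x y} → Unique (leaves T) → cherry x y ⊑ T → σ x ≢ σ y → BestMatch σ T x y
  cherry⇒BestMatch {T} {x} {y} u ch⊑T σx≢σy = ⊑-trans x∈ch ch⊑T , ⊑-trans y∈ch ch⊑T , σx≢σy , nearest
    where
      x∈ch : x ∈L cherry x y
      x∈ch = there (here refl) here
      y∈ch : y ∈L cherry x y
      y∈ch = there (there (here refl)) here
      nearest : ∀ y' → y' ∈L T → σ y' ≡ σ y → ∀ a b → IsLca T a x y → IsLca T b x y' → a ⊑ b
      nearest y' _ σy'≡σy a b (_ , _ , _ , a-least) (b⊑T , x∈b , y'∈b , _) =
        ⊑-trans (a-least _ ch⊑T x∈ch y∈ch) ch⊑b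
        where
          ch⊑b : cherry x y ⊑ b
          ch⊑b with ⊑-comparable u ch⊑T b⊑T x∈ch x∈b
          ... | inj₁ ch⊑b = ch⊑b
          ... | inj₂ here = here
          ... | inj₂ (there c∈ b⊑c) = ⊥-elim (σx≢σy (trans (cong σ x≡y') σy'≡σy))
            where
              x≡y' : x ≡ y'
              x≡y' = ∈L-leaf-child⇒≡ {zs = x ∷ y ∷ []} c∈ (⊑-trans x∈b b⊑c) (⊑-trans y'∈b b⊑c)

  -- lca(x, z) is the cherry, while lca(x, y) is its parent.
  cherryStar⇒¬BestMatch : ∀ {T x y z rest} → Unique (leaves T) → cherryStar (x ∷ z ∷ rest) ⊑ T →
                          y ∈ₗ rest → x ≢ z → y ≢ x → y ≢ z → σ z ≡ σ y → ¬ BestMatch σ T x y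
  cherryStar⇒¬BestMatch {T} {x} {y} {z} {r ∷ rs} u A⊑T y∈rest x≢z y≢x y≢z σz≡σy (_ , _ , _ , nearest) =
    A⋢cherry (nearest z (⊑-trans z∈ch ch⊑T) σz≡σy A (cherry x z) lca-xy lca-xz)
    where
      A : Tree n
      A = node (cherry x z ∷ map leaf (r ∷ rs))
      ch⊑T : cherry x z ⊑ T
      ch⊑T = ⊑-trans (there (here refl) here) A⊑T
      x∈ch : x ∈L cherry x z
      x∈ch = there (here refl) here
      z∈ch : z ∈L cherry x z
      z∈ch = there (there (here refl)) here
      lca-xz : IsLca T (cherry x z) x z
      lca-xz = IsLca-node u ch⊑T x∈ch z∈ch
                 (λ c∈ x∈c z∈c → x≢z (∈L-leaf-child⇒≡ {zs = x ∷ z ∷ []} c∈ x∈c z∈c))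
      separated : ∀ {c} → c ∈ₗ cherry x z ∷ map leaf (r ∷ rs) → x ∈L c → y ∈L c → ⊥
      separated (here refl) _ y∈ch = [ y≢x , y≢z ]′ (∈L-cherry y∈ch)
      separated (there c∈) x∈c y∈c = y≢x (∈L-leaf-child⇒≡ c∈ y∈c x∈c)
      lca-xy : IsLca T A x y
      lca-xy = IsLca-node u A⊑T (there (here refl) x∈ch) (there (there (∈-map⁺ leaf y∈rest)) here) separated
      A⋢cherry : ¬ A ⊑ cherry x z
      A⋢cherry (there (here refl) A⊑x) with ⊑-leaf A⊑x
      ... | ()
      A⋢cherry (there (there (here refl)) A⊑z) with ⊑-leaf A⊑z
      ... | ()

Enumerates : ∀ {n} → List (Fin n) → Subset n → Set
Enumerates l Q = Unique l × (∀ x → x ∈ₗ l ⇔ x ∈ Q)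

enumerate : ∀ {n} → List (Fin n) → Subset n → List (Fin n)
enumerate ps Q = filter (_∈? Q) ps ++ filter (_∉? ps) (filter (_∈? Q) (allFin _))

enumerate-enumerates : ∀ {n} {ps : List (Fin n)} {Q} → Unique ps → Enumerates (enumerate ps Q) Q
enumerate-enumerates {n} {ps} {Q} ps! =
    UniqueP.++⁺ (UniqueP.filter⁺ (_∈? Q) ps!)
                (UniqueP.filter⁺ (_∉? ps) (UniqueP.filter⁺ (_∈? Q) (UniqueP.allFin⁺ n))) separate
  , λ x → mk⇔ (to x) (from x)
  where
    inQ : List (Fin n)
    inQ = filter (_∈? Q) (allFin n)
    separate : Disjoint (filter (_∈? Q) ps) (filter (_∉? ps) inQ)
    separate (v∈ps , v∉ps) = proj₂ (∈-filter⁻ (_∉? ps) {xs = inQ} v∉ps) (proj₁ (∈-filter⁻ (_∈? Q) {xs = ps} v∈ps))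
    to : ∀ x → x ∈ₗ enumerate ps Q → x ∈ Q
    to x x∈ with ∈-++⁻ (filter (_∈? Q) ps) x∈
    ... | inj₁ x∈ps = proj₂ (∈-filter⁻ (_∈? Q) {xs = ps} x∈ps)
    ... | inj₂ x∈rest = proj₂ (∈-filter⁻ (_∈? Q) {xs = allFin n} (proj₁ (∈-filter⁻ (_∉? ps) {xs = inQ} x∈rest)))
    from : ∀ x → x ∈ Q → x ∈ₗ enumerate ps Q
    from x x∈Q with x ∈ₗ? ps
    ... | yes x∈ps = ∈-++⁺ˡ (∈-filter⁺ (_∈? Q) x∈ps x∈Q)
    ... | no x∉ps = ∈-++⁺ʳ _ (∈-filter⁺ (_∉? ps) (∈-filter⁺ (_∈? Q) (∈-allFin x) x∈Q) x∉ps)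

enumerate-pair : ∀ {n} {x z : Fin n} {Q} → x ∈ Q → z ∈ Q → ∃ λ rest → enumerate (x ∷ z ∷ []) Q ≡ x ∷ z ∷ rest
enumerate-pair {n} {x} {z} {Q} x∈Q z∈Q =
  rest , cong (_++ rest) (trans (filter-accept (_∈? Q) x∈Q) (cong (x ∷_) (filter-accept (_∈? Q) z∈Q)))
  where
    rest : List (Fin n)
    rest = filter (_∉? (x ∷ z ∷ [])) (filter (_∈? Q) (allFin n))

DisjointSubsets : ∀ {n} → Subset n → Subset n → Set
DisjointSubsets P Q = ∀ x → x ∈ P → x ∈ Q → ⊥

partition-disjoint : ∀ {n} {W : Subset n} {𝒱} → IsPartition W 𝒱 → AllPairs DisjointSubsets 𝒱
partition-disjoint {𝒱 = 𝒱} (_ , _ , _ , disjoint) =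
  subst (AllPairs DisjointSubsets) (tabulate-lookup 𝒱) (AllPairsP.tabulate⁺ (λ {i} {j} → disjoint i j))

node-map-∈𝒯 : ∀ {n} {W : Subset n} {𝒱} (f : Subset n → Tree n) →
              (∀ {Q} → Nonempty Q → Phylo (f Q)) → (∀ Q → Enumerates (leaves (f Q)) Q) →
              IsPartition W 𝒱 → 2 ≤ length 𝒱 → InTrees W 𝒱 (node (map f 𝒱))
node-map-∈𝒯 {n} {W} {𝒱} f phylo enum part@(nonempty , parts⊆W , covers , _) 2≤∣𝒱∣ =
    nodeP (subst (2 ≤_) (sym (length-map f 𝒱)) 2≤∣𝒱∣) (AllP.map⁺ (All.map phylo nonempty))
  , subst Unique (sym (leavesL≡concat (map f 𝒱)))
      (UniqueP.concat⁺ (AllP.map⁺ (AllP.map⁺ (All.universal (proj₁ ∘ enum) 𝒱)))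
                       (AllPairsP.map⁺ (AllPairsP.map⁺ (AllPairs.map leaves-disjoint (partition-disjoint part)))))
  , (λ x → mk⇔ (to x) (from x))
  , _ , refl
  , AllP.map⁺ (All.tabulate (λ {Q} Q∈𝒱 → Any.map (λ { refl → same Q }) Q∈𝒱))
  , All.tabulate (λ {Q} Q∈𝒱 → Any.map (λ { refl → same Q }) (∈-map⁺ f Q∈𝒱))
  where
    same : ∀ Q → SameLeaves (f Q) Q
    same Q x = mk⇔ (Equivalence.to (proj₂ (enum Q) x) ∘ ∈L⇒∈leaves)
                   (∈leaves⇒∈L (f Q) ∘ Equivalence.from (proj₂ (enum Q) x))
    leaves-disjoint : ∀ {P Q} → DisjointSubsets P Q → Disjoint (leaves (f P)) (leaves (f Q))
    leaves-disjoint {P} {Q} P#Q (v∈P , v∈Q) =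
      P#Q _ (Equivalence.to (proj₂ (enum P) _) v∈P) (Equivalence.to (proj₂ (enum Q) _) v∈Q)
    to : ∀ x → x ∈ W → x ∈L node (map f 𝒱)
    to x x∈W = ∈L-node⁺ (AnyP.map⁺ (Any.map (λ {Q} → Equivalence.from (same Q x)) (covers x x∈W)))
    from : ∀ x → x ∈L node (map f 𝒱) → x ∈ W
    from x x∈T =
      let Q⊆W , x∈Q = All.lookupAny parts⊆W (Any.map (λ {Q} → Equivalence.to (same Q x)) (AnyP.map⁻ (∈L-node⁻ x∈T)))
      in Q⊆W x∈Q

partitionTree : ∀ {n} → List (Fin n) → List (Subset n) → Tree n
partitionTree ps 𝒱 = node (map (cherryStar ∘ enumerate ps) 𝒱)

partitionTree-∈𝒯 : ∀ {n} {W : Subset n} {𝒱 ps} → Unique ps → IsPartition W 𝒱 → 2 ≤ length 𝒱 →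
                   InTrees W 𝒱 (partitionTree ps 𝒱)
partitionTree-∈𝒯 {ps = ps} ps! = node-map-∈𝒯 (cherryStar ∘ enumerate ps) phylo enum
  where
    enum : ∀ Q → Enumerates (leaves (cherryStar (enumerate ps Q))) Q
    enum Q = subst (λ l → Enumerates l Q) (sym (leaves-cherryStar (enumerate ps Q))) (enumerate-enumerates ps!)
    phylo : ∀ {Q} → Nonempty Q → Phylo (cherryStar (enumerate ps Q))
    phylo (x , x∈Q) = cherryStar-phylo (Equivalence.from (proj₂ (enumerate-enumerates ps!) x) x∈Q)

cherryStar-in-partitionTree : ∀ {n} {x z : Fin n} {Q 𝒱} → x ≢ z → Q ∈ₗ 𝒱 → x ∈ Q → z ∈ Q →
  ∃ λ rest → cherryStar (x ∷ z ∷ rest) ⊑ partitionTree (x ∷ z ∷ []) 𝒱 ×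
             (∀ y → y ∈ Q → y ≢ x → y ≢ z → y ∈ₗ rest)
cherryStar-in-partitionTree {n} {x} {z} {Q} {𝒱} x≢z Q∈𝒱 x∈Q z∈Q with enumerate-pair x∈Q z∈Q
... | rest , enumeration≡ = rest , star⊑T , others
  where
    star⊑T : cherryStar (x ∷ z ∷ rest) ⊑ partitionTree (x ∷ z ∷ []) 𝒱
    star⊑T = there (∈-map⁺ (cherryStar ∘ enumerate (x ∷ z ∷ [])) Q∈𝒱)
                   (subst (λ l → cherryStar l ⊑ cherryStar (enumerate _ Q)) enumeration≡ here)
    others : ∀ y → y ∈ Q → y ≢ x → y ≢ z → y ∈ₗ rest
    others y y∈Q y≢x y≢z
      with subst (y ∈ₗ_) enumeration≡
                 (Equivalence.from (proj₂ (enumerate-enumerates ((x≢z ∷ []) ∷ [] ∷ [])) y) y∈Q)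
    ... | here y≡x = ⊥-elim (y≢x y≡x)
    ... | there (here y≡z) = ⊥-elim (y≢z y≡z)
    ... | there (there y∈rest) = y∈rest

SoleColourIn : ∀ {n} {C : Set} → (Fin n → C) → Subset n → Fin n → Set
SoleColourIn σ Q y = ∀ z → z ∈ Q → σ z ≡ σ y → z ≡ y

module _ {n : ℕ} {C : Set} (σ : Fin n → C) {G : Graph n} {V : Subset n} {𝒱 : List (Subset n)}
         (part : IsPartition V 𝒱) (2≤∣𝒱∣ : 2 ≤ length 𝒱) where

  private
    colour-≢ : ∀ {a b} → σ a ≢ σ b → a ≢ b
    colour-≢ σa≢σb refl = σa≢σb refl

    cherryTree-∈𝒯 : ∀ {x z} → x ≢ z → InTrees V 𝒱 (partitionTree (x ∷ z ∷ []) 𝒱)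
    cherryTree-∈𝒯 x≢z = partitionTree-∈𝒯 ((x≢z ∷ []) ∷ [] ∷ []) part 2≤∣𝒱∣

    leaves-unique : ∀ {T} → InTrees V 𝒱 T → Unique (leaves T)
    leaves-unique (_ , u , _) = u

    leaves-match : ∀ {T} → InTrees V 𝒱 T → ∀ v → (v ∈ V) ⇔ (v ∈L T)
    leaves-match (_ , _ , match , _) = match

  Uset⇒colours-differ : Proper G σ → ∀ {x y} → Uset σ G V 𝒱 x y → σ x ≢ σ y
  Uset⇒colours-differ proper (_ , _ , edited) with edited _ (partitionTree-∈𝒯 [] part 2≤∣𝒱∣)
  ... | inj₁ (Gxy , _) = proper _ _ Gxy
  ... | inj₂ ((_ , _ , σx≢σy , _) , _) = σx≢σy

  △Uset-proper : Proper G σ → Proper (G △ Uset σ G V 𝒱) σ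
  △Uset-proper proper x y (inj₁ (Gxy , _)) = proper x y Gxy
  △Uset-proper proper x y (inj₂ (Uxy , _)) = Uset⇒colours-differ proper Uxy

  Uset-within-part : Proper G σ → ∀ {x y Q} → Uset σ G V 𝒱 x y → Q ∈ₗ 𝒱 → x ∈ Q → y ∈ Q →
                     ¬ G x y × SoleColourIn σ Q y
  Uset-within-part proper {x} {y} {Q} Uxy@(_ , _ , edited) Q∈𝒱 x∈Q y∈Q = ¬Gxy , sole
    where
      σx≢σy : σ x ≢ σ y
      σx≢σy = Uset⇒colours-differ proper Uxy
      ¬Gxy : ¬ G x y
      ¬Gxy Gxy = [ (λ { (_ , ¬BM) → ¬BM BM }) , (λ { (_ , ¬G) → ¬G Gxy }) ]′ (edited _ (cherryTree-∈𝒯 x≢y))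
        where
          x≢y : x ≢ y
          x≢y = colour-≢ σx≢σy
          BM : BestMatch σ (partitionTree (x ∷ y ∷ []) 𝒱) x y
          BM = let rest , star⊑T , _ = cherryStar-in-partitionTree x≢y Q∈𝒱 x∈Q y∈Q
               in cherry⇒BestMatch σ (leaves-unique (cherryTree-∈𝒯 x≢y))
                                     (⊑-trans (cherry⊑cherryStar x y rest) star⊑T) σx≢σy
      sole : SoleColourIn σ Q y
      sole z z∈Q σz≡σy with z ≟ y
      ... | yes z≡y = z≡y
      ... | no z≢y = ⊥-elim ([ (λ { (Gxy , _) → ¬Gxy Gxy }) , (λ { (BM , _) → ¬BM BM }) ]′ (edited _ (cherryTree-∈𝒯 x≢z)))
        where
          x≢z : x ≢ z
          x≢z = colour-≢ (λ σx≡σz → σx≢σy (trans σx≡σz σz≡σy))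
          y≢x : y ≢ x
          y≢x = colour-≢ (σx≢σy ∘ sym)
          ¬BM : ¬ BestMatch σ (partitionTree (x ∷ z ∷ []) 𝒱) x y
          ¬BM = let _ , star⊑T , others = cherryStar-in-partitionTree x≢z Q∈𝒱 x∈Q z∈Q
                in cherryStar⇒¬BestMatch σ (leaves-unique (cherryTree-∈𝒯 x≢z)) star⊑T
                     (others y y∈Q y≢x (z≢y ∘ sym)) x≢z y≢x (z≢y ∘ sym) σz≡σy

  sole-colour⇒¬Uset : ∀ {x y} → G x y → σ x ≢ σ y → (x ∈ V → y ∈ V → SoleColourIn σ V y) →
                      ¬ Uset σ G V 𝒱 x y
  sole-colour⇒¬Uset {x} {y} Gxy σx≢σy sole (x∈V , y∈V , edited) =
    [ (λ { (_ , ¬BM) → ¬BM BM }) , (λ { (_ , ¬G) → ¬G Gxy }) ]′ (edited _ T∈𝒯)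
    where
      T∈𝒯 : InTrees V 𝒱 (partitionTree [] 𝒱)
      T∈𝒯 = partitionTree-∈𝒯 [] part 2≤∣𝒱∣
      BM : BestMatch σ (partitionTree [] 𝒱) x y
      BM = sole-colour⇒BestMatch σ (Equivalence.to (leaves-match T∈𝒯 x) x∈V)
             (Equivalence.to (leaves-match T∈𝒯 y) y∈V) σx≢σy
             (λ y' y'∈T → sole x∈V y∈V y' (Equivalence.from (leaves-match T∈𝒯 y') y'∈T))

DisjointArcs : ∀ {n} → Graph n → Graph n → Set
DisjointArcs u v = ∀ x y → u x y → v x y → ⊥

module _ {n : ℕ} {C : Set} (σ : Fin n → C) where

  ArcsWithin : Subset n → Graph n → Set
  ArcsWithin V u = ∀ x y → u x y → x ∈ V × y ∈ V

  ArcsWithinSome : List (Subset n) → Graph n → Set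
  ArcsWithinSome 𝒱 u = ∀ x y → u x y → Any (λ Q → x ∈ Q × y ∈ Q) 𝒱

  mutual
    Run-edits-within : ∀ {V G G' us} → Run σ V G G' us → All (ArcsWithin V) us
    Run-edits-within (single _) = []
    Run-edits-within {V} (split 𝒱 _ (_ , parts⊆V , _) _ rest) =
        (λ _ _ (x∈V , y∈V , _) → x∈V , y∈V)
      ∷ All.map (λ within x y uxy → inside (within x y uxy)) (RunAll-edits-within rest)
      where
        inside : ∀ {x y} → Any (λ Q → x ∈ Q × y ∈ Q) 𝒱 → x ∈ V × y ∈ V
        inside both∈ = let Q⊆V , x∈Q , y∈Q = All.lookupAny parts⊆V both∈ in Q⊆V x∈Q , Q⊆V y∈Q

    RunAll-edits-within : ∀ {𝒱 G G' us} → RunAll σ 𝒱 G G' us → All (ArcsWithinSome 𝒱) us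
    RunAll-edits-within done = []
    RunAll-edits-within (next r rs) =
      AllP.++⁺ (All.map (λ within x y uxy → here (within x y uxy)) (Run-edits-within r))
               (All.map (λ within x y uxy → there (within x y uxy)) (RunAll-edits-within rs))

  mutual
    Run-proper : ∀ {V G G' us} → Proper G σ → Run σ V G G' us → Proper G' σ
    Run-proper proper (single _) = proper
    Run-proper proper (split _ _ part 2≤ rest) = RunAll-proper (△Uset-proper σ part 2≤ proper) rest

    RunAll-proper : ∀ {𝒱 G G' us} → Proper G σ → RunAll σ 𝒱 G G' us → Proper G' σ
    RunAll-proper proper done = proper
    RunAll-proper proper (next r rs) = RunAll-proper (Run-proper proper r) rs

  SoleColourIfIn : Fin n → Fin n → Subset n → Set
  SoleColourIfIn x y V = x ∈ V → y ∈ V → SoleColourIn σ V y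

  mutual
    Run-keeps-arc : ∀ {V G G' us x y} → Run σ V G G' us → G x y → σ x ≢ σ y → SoleColourIfIn x y V →
                    G' x y × All (λ u → ¬ u x y) us
    Run-keeps-arc (single _) Gxy _ _ = Gxy , []
    Run-keeps-arc {G = G} (split 𝒱 _ part 2≤ rest) Gxy σx≢σy sole =
      let ¬Uxy = sole-colour⇒¬Uset σ {G} part 2≤ Gxy σx≢σy sole
          G'xy , untouched = RunAll-keeps-arc rest (inj₁ (Gxy , ¬Uxy)) σx≢σy
                               (All.map restrict (proj₁ (proj₂ part)))
      in G'xy , ¬Uxy ∷ untouched
      where
        restrict : ∀ {Q} → Q ⊆ _ → SoleColourIfIn _ _ Q
        restrict Q⊆V x∈Q y∈Q z z∈Q = sole (Q⊆V x∈Q) (Q⊆V y∈Q) z (Q⊆V z∈Q)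

    RunAll-keeps-arc : ∀ {𝒱 G G' us x y} → RunAll σ 𝒱 G G' us → G x y → σ x ≢ σ y →
                       All (SoleColourIfIn x y) 𝒱 → G' x y × All (λ u → ¬ u x y) us
    RunAll-keeps-arc done Gxy _ _ = Gxy , []
    RunAll-keeps-arc (next r rs) Gxy σx≢σy (sole ∷ soles) =
      let G₁xy , untouched₁ = Run-keeps-arc r Gxy σx≢σy sole
          G₂xy , untouched₂ = RunAll-keeps-arc rs G₁xy σx≢σy soles
      in G₂xy , AllP.++⁺ untouched₁ untouched₂

  mutual
    Run-disjoint : ∀ {V G G' us} → Proper G σ → Run σ V G G' us → AllPairs DisjointArcs us
    Run-disjoint _ (single _) = []
    Run-disjoint {G = G} proper (split 𝒱 _ part 2≤ rest) =
      All.tabulate later-untouched ∷ RunAll-disjoint (△Uset-proper σ part 2≤ proper) (partition-disjoint part) rest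
      where
        later-untouched : ∀ {v} → v ∈ₗ _ → DisjointArcs (Uset σ G _ 𝒱) v
        later-untouched v∈ x y Uxy vxy =
          let _ , Q∈𝒱 , x∈Q , y∈Q = find (All.lookup (RunAll-edits-within rest) v∈ x y vxy)
              ¬Gxy , _ = Uset-within-part σ part 2≤ proper Uxy Q∈𝒱 x∈Q y∈Q
              sole = All.tabulate (λ Q'∈𝒱 x∈Q' y∈Q' → proj₂ (Uset-within-part σ part 2≤ proper Uxy Q'∈𝒱 x∈Q' y∈Q'))
              _ , untouched = RunAll-keeps-arc rest (inj₂ (Uxy , ¬Gxy)) (Uset⇒colours-differ σ part 2≤ proper Uxy) sole
          in All.lookup untouched v∈ vxy

    RunAll-disjoint : ∀ {𝒱 G G' us} → Proper G σ → AllPairs DisjointSubsets 𝒱 → RunAll σ 𝒱 G G' us →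
                      AllPairs DisjointArcs us
    RunAll-disjoint _ _ done = []
    RunAll-disjoint proper (V#𝒱 ∷ 𝒱#) (next r rs) =
      AllPairsP.++⁺ (Run-disjoint proper r) (RunAll-disjoint (Run-proper proper r) 𝒱# rs)
        (All.map (λ inV → All.map (λ inSome x y ux vx → apart (inV x y ux) (inSome x y vx)) (RunAll-edits-within rs))
                 (Run-edits-within r))
      where
        apart : ∀ {x y} → x ∈ _ × y ∈ _ → Any (λ Q → x ∈ Q × y ∈ Q) _ → ⊥
        apart (x∈V , _) both∈ = let V#Q , x∈Q , _ = All.lookupAny V#𝒱 both∈ in V#Q _ x∈V x∈Q

AllPairs⇒PairwiseDisjoint : ∀ {n} {us : List (Graph n)} → AllPairs DisjointArcs us → PairwiseDisjoint us
AllPairs⇒PairwiseDisjoint (_ ∷ _) zero zero 0≢0 = ⊥-elim (0≢0 refl)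
AllPairs⇒PairwiseDisjoint (u# ∷ _) zero (suc j) _ x y ux vx = All.lookup u# (∈-lookup j) x y ux vx
AllPairs⇒PairwiseDisjoint (u# ∷ _) (suc i) zero _ x y vx ux = All.lookup u# (∈-lookup i) x y ux vx
AllPairs⇒PairwiseDisjoint (_ ∷ us#) (suc i) (suc j) i≢j = AllPairs⇒PairwiseDisjoint us# i j (i≢j ∘ cong suc)

lemma2 : ∀ {n : ℕ} {C : Set} (E : Graph n) (σ : Fin n → C) →
         Loopless E → Proper E σ → 0 < n →
         ∀ (G' : Graph n) (us : List (Graph n)) →
         Run σ ⊤ E G' us → PairwiseDisjoint us
lemma2 E σ _ proper _ G' us run = AllPairs⇒PairwiseDisjoint (Run-disjoint σ proper run)
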